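{- Let $n \ge 2$ be an integer. Suppose there exist positive integers $x_0, t_0$ with $5x_0 > n$ and a nonnegative integer $q$ such that $$t_0^2 (5x_0 - n)^2 - 2 n t_0 x_0 = q^2.$$ Then $y = t_0(5x_0 - n) - q$ and $z = t_0(5x_0 - n) + q$ are positive integers and $$\frac{5}{n} = \frac{1}{x_0} + \frac{1}{y} + \frac{1}{z}.$$ -}

module Defs where

open import Data.Nat as ℕ using (ℕ)
open import Data.Integer as ℤ using (ℤ; +_; _<_; +<+)
open import Data.Rational as ℚ using (ℚ)

frac : ℤ → (d : ℤ) → + 0 < d → ℚ
frac a (+ ℕ.suc k) _ = a ℚ./ ℕ.suc k
frac a (+ ℕ.zero) (+<+ ())

≥2⇒pos : ∀ {n : ℕ} → n ℕ.≥ 2 → + 0 < + n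
≥2⇒pos (ℕ.s≤s _) = +<+ (ℕ.s≤s ℕ.z≤n)

{-# OPTIONS --safe #-}
-- With A = t₀(5x₀ − n) and P = 2nt₀x₀ the hypothesis says A² − P = q², so y = A − q and
-- z = A + q are the roots of X² − 2AX + P: yz = P and y + z = 2A. Clearing denominators,
-- 5/n = 1/x₀ + 1/y + 1/z becomes 5x₀·P = n(P + 2Ax₀), a polynomial identity in n, x₀, t₀.
-- Positivity of y follows from yz = P > 0 and z > 0.
module Submission where

open import Defs
open import Data.Nat as ℕ using (ℕ; _≥_)
open import Data.Integer as ℤ using (ℤ; +_; _<_; _*_; _-_; _+_; +<+)
import Data.Integer.Properties as ℤP
open import Data.Integer.Tactic.RingSolver using (solve-∀; solve)
open import Algebra.Properties.CommutativeSemigroup ℤP.*-commutativeSemigroup using (interchange)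
open import Data.Rational as ℚ using (ℚ; fromℚᵘ; toℚᵘ)
import Data.Rational.Properties as ℚP
open import Data.Rational.Unnormalised as ℚᵘ using (mkℚᵘ; *≡*)
import Data.Rational.Unnormalised.Properties as ℚᵘP
open import Data.List using ([]; _∷_)
open import Data.Product using (Σ; _,_)
open import Relation.Binary.PropositionalEquality

*-pos : ∀ {i j} → + 0 < i → + 0 < j → + 0 < i * j
*-pos {+ ℕ.suc _} {+ ℕ.suc _} _ _ = +<+ (ℕ.s≤s ℕ.z≤n)
*-pos {+ 0} (+<+ ()) _
*-pos {+ ℕ.suc _} {+ 0} _ (+<+ ())

pos-factor : ∀ {i j} → + 0 < j → + 0 < i * j → + 0 < i
pos-factor {i} {j@(+ ℕ.suc _)} _ ij>0 = ℤP.*-cancelʳ-<-nonNeg {+ 0} {i} j ij>0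
pos-factor {j = + 0} (+<+ ()) _

fromℚᵘ-homo-+ : ∀ p q → fromℚᵘ (p ℚᵘ.+ q) ≡ fromℚᵘ p ℚ.+ fromℚᵘ q
fromℚᵘ-homo-+ p q = ℚP.toℚᵘ-injective (begin
  toℚᵘ (fromℚᵘ (p ℚᵘ.+ q))                 ≈⟨ ℚP.toℚᵘ-fromℚᵘ (p ℚᵘ.+ q) ⟩
  p ℚᵘ.+ q                                  ≈⟨ ℚᵘP.+-cong (ℚP.toℚᵘ-fromℚᵘ p) (ℚP.toℚᵘ-fromℚᵘ q) ⟨
  toℚᵘ (fromℚᵘ p) ℚᵘ.+ toℚᵘ (fromℚᵘ q)     ≈⟨ ℚP.toℚᵘ-homo-+ (fromℚᵘ p) (fromℚᵘ q) ⟨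
  toℚᵘ (fromℚᵘ p ℚ.+ fromℚᵘ q)             ∎)
  where open ℚᵘP.≃-Reasoning

-- On a denominator + suc k, frac a is definitionally fromℚᵘ (mkℚᵘ a k).
cross-mult⇒frac≡ : ∀ {a b c d} (b>0 : + 0 < b) (d>0 : + 0 < d) →
                   a * d ≡ c * b → frac a b b>0 ≡ frac c d d>0
cross-mult⇒frac≡ {a} {+ ℕ.suc k} {c} {+ ℕ.suc l} _ _ ad≡cb = ℚP.fromℚᵘ-cong {mkℚᵘ a k} {mkℚᵘ c l} (*≡* ad≡cb)
cross-mult⇒frac≡ {b = + 0} (+<+ ()) _ _
cross-mult⇒frac≡ {b = + ℕ.suc _} {d = + 0} _ (+<+ ()) _

frac-+ : ∀ {a b c d} (b>0 : + 0 < b) (d>0 : + 0 < d) →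
         frac a b b>0 ℚ.+ frac c d d>0 ≡ frac (a * d + c * b) (b * d) (*-pos b>0 d>0)
frac-+ {a} {+ ℕ.suc k} {c} {+ ℕ.suc l} _ _ = sym (fromℚᵘ-homo-+ (mkℚᵘ a k) (mkℚᵘ c l))
frac-+ {b = + 0} (+<+ ()) _
frac-+ {b = + ℕ.suc _} {d = + 0} _ (+<+ ())

frac≡sum-of-unit-fracs : ∀ {a N x y z} (N>0 : + 0 < N) (x>0 : + 0 < x) (y>0 : + 0 < y) (z>0 : + 0 < z) →
  a * (x * y * z) ≡ N * (y * z + x * (y + z)) →
  frac a N N>0 ≡ frac (+ 1) x x>0 ℚ.+ frac (+ 1) y y>0 ℚ.+ frac (+ 1) z z>0
frac≡sum-of-unit-fracs {a} {N} {x} {y} {z} N>0 x>0 y>0 z>0 eq = begin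
  frac a N N>0
    ≡⟨ cross-mult⇒frac≡ N>0 xyz>0 (trans eq (solve (N ∷ x ∷ y ∷ z ∷ []))) ⟩
  frac ((+ 1 * y + + 1 * x) * z + + 1 * (x * y)) (x * y * z) xyz>0
    ≡⟨ frac-+ xy>0 z>0 ⟨
  frac (+ 1 * y + + 1 * x) (x * y) xy>0 ℚ.+ frac (+ 1) z z>0
    ≡⟨ cong (ℚ._+ frac (+ 1) z z>0) (frac-+ x>0 y>0) ⟨
  frac (+ 1) x x>0 ℚ.+ frac (+ 1) y y>0 ℚ.+ frac (+ 1) z z>0 ∎
  where
  open ≡-Reasoning
  xy>0 : + 0 < x * y
  xy>0 = *-pos x>0 y>0
  xyz>0 : + 0 < x * y * z
  xyz>0 = *-pos xy>0 z>0

product-of-roots : ∀ A q P → A * A - P ≡ q * q → (A - q) * (A + q) ≡ P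
product-of-roots A q P A²-P≡q² = begin
  (A - q) * (A + q)    ≡⟨ solve (A ∷ q ∷ []) ⟩
  A * A - q * q        ≡⟨ cong (A * A -_) A²-P≡q² ⟨
  A * A - (A * A - P)  ≡⟨ solve (A ∷ P ∷ []) ⟩
  P                    ∎
  where open ≡-Reasoning

sum-of-roots : ∀ A q → (A - q) + (A + q) ≡ + 2 * A
sum-of-roots = solve-∀

unit-fracs-identity : ∀ a n x t y z → y * z ≡ + 2 * n * t * x → y + z ≡ + 2 * (t * (a * x - n)) →
                      a * (x * y * z) ≡ n * (y * z + x * (y + z))
unit-fracs-identity a n x t y z yz≡ y+z≡ = begin
  a * (x * y * z)                                        ≡⟨ solve (a ∷ x ∷ y ∷ z ∷ []) ⟩
  a * x * (y * z)                                        ≡⟨ cong (a * x *_) yz≡ ⟩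
  a * x * (+ 2 * n * t * x)                              ≡⟨ solve (a ∷ n ∷ x ∷ t ∷ []) ⟩
  n * (+ 2 * n * t * x + x * (+ 2 * (t * (a * x - n))))  ≡⟨ cong₂ (λ u v → n * (u + x * v)) yz≡ y+z≡ ⟨
  n * (y * z + x * (y + z))                              ∎
  where open ≡-Reasoning

mainTheorem3 : (n : ℕ) → (n≥2 : n ≥ 2) → (x₀ t₀ q : ℤ) → (px : + 0 < x₀) → + 0 < t₀ → + 0 < + 5 * x₀ - + n → + 0 ℤ.≤ q
    → t₀ * t₀ * ((+ 5 * x₀ - + n) * (+ 5 * x₀ - + n)) - + 2 * + n * t₀ * x₀ ≡ q * q
    → Σ (+ 0 < t₀ * (+ 5 * x₀ - + n) - q) λ py → Σ (+ 0 < t₀ * (+ 5 * x₀ - + n) + q) λ pz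
      → frac (+ 5) (+ n) (≥2⇒pos n≥2) ≡ frac (+ 1) x₀ px ℚ.+ frac (+ 1) (t₀ * (+ 5 * x₀ - + n) - q) py ℚ.+ frac (+ 1) (t₀ * (+ 5 * x₀ - + n) + q) pz
mainTheorem3 n n≥2 x t q x>0 t>0 B>0 q≥0 t²B²-P≡q² =
  y>0 , z>0 , frac≡sum-of-unit-fracs n>0 x>0 y>0 z>0
                (unit-fracs-identity (+ 5) (+ n) x t (A - q) (A + q) yz≡P (sum-of-roots A q))
  where
  n>0 : + 0 < + n
  n>0 = ≥2⇒pos n≥2
  B A P : ℤ
  B = + 5 * x - + n
  A = t * B
  P = + 2 * + n * t * x
  yz≡P : (A - q) * (A + q) ≡ P
  yz≡P = product-of-roots A q P (trans (cong (_- P) (sym (interchange t t B B))) t²B²-P≡q²)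
  z>0 : + 0 < A + q
  z>0 = ℤP.+-mono-<-≤ (*-pos t>0 B>0) q≥0
  P>0 : + 0 < P
  P>0 = *-pos (*-pos (*-pos {+ 2} (+<+ (ℕ.s≤s ℕ.z≤n)) n>0) t>0) x>0
  y>0 : + 0 < A - q
  y>0 = pos-factor z>0 (subst (+ 0 <_) (sym yz≡P) P>0)
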